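{- Let $T$ be a finite tree with at least two vertices and a proper 2-coloring into red and blue. Then $T$ is well-totally dominated if and only if every minimal red-dominating set of $T$ has the same size and every minimal blue-dominating set of $T$ has the same size.
   Context: $N(v)$ is the open neighborhood of $v$ and $N(S)=\bigcup_{v\in S}N(v)$. $V_\mathcal{R}$, $V_\mathcal{B}$ denote the sets of red and blue vertices. A red-dominating set is a set $D$ with $N(D)=V_\mathcal{R}$, a blue-dominating set is a set $D$ with $N(D)=V_\mathcal{B}$; such a set is minimal if no proper subset $D'\subsetneq D$ has $N(D')=N(D)$. A total dominating set is a set $S$ with $N(S)=V(T)$; $T$ is well-totally dominated if all its inclusion-minimal total dominating sets have the same size. -}

module Defs where

open import Data.Nat using (ℕ; zero; suc; _≥_; _∸_)
open import Data.Fin using (Fin; _<_)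
open import Data.Fin.Subset using (Subset; _∈_; _⊂_; ∣_∣)
open import Data.Bool using (Bool; true; false)
open import Data.List using (List; []; _∷_; length)
open import Data.Product using (_×_; Σ; ∃; ∃-syntax; _,_)
open import Data.Sum using (_⊎_)
open import Relation.Nullary using (¬_)
open import Relation.Binary.PropositionalEquality using (_≡_)
open import Function.Bundles using (_⇔_)

record Graph (n : ℕ) : Set where
  field
    adj   : Fin n → Fin n → Bool
    sym   : ∀ u v → adj u v ≡ adj v u
    irrfl : ∀ v → adj v v ≡ false

open Graph public

Adj : ∀ {n} → Graph n → Fin n → Fin n → Set
Adj G u v = adj G u v ≡ true

data Walk {n} (G : Graph n) : Fin n → Fin n → Set where
  here : ∀ {u} → Walk G u u
  step : ∀ {u w v} → Adj G u w → Walk G w v → Walk G u v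

Connected : ∀ {n} → Graph n → Set
Connected G = ∀ u v → Walk G u v

data Path {n} (G : Graph n) : List (Fin n) → Set where
  one  : ∀ v → Path G (v ∷ [])
  cons : ∀ {u w vs} → Adj G u w → Path G (w ∷ vs) → Path G (u ∷ w ∷ vs)

open import Data.List.Relation.Unary.Unique.Propositional using (Unique)
open import Data.List using (last; head)
open import Data.Maybe using (just)

HasCycle : ∀ {n} → Graph n → Set
HasCycle {n} G = Σ (List (Fin n)) λ vs → Path G vs × Unique vs × length vs ≥ 3
  × Σ (Fin n) λ a → Σ (Fin n) λ b → head vs ≡ just a × last vs ≡ just b × Adj G b a

IsTree : ∀ {n} → Graph n → Set
IsTree G = Connected G × ¬ HasCycle G

data Color : Set where
  red blue : Color

ProperColoring : ∀ {n} → Graph n → (Fin n → Color) → Set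
ProperColoring G c = ∀ u v → Adj G u v → ¬ (c u ≡ c v)

-- v ∈ N(D): v has a neighbour in D (open neighbourhood)
InN : ∀ {n} → Graph n → Subset n → Fin n → Set
InN G D v = ∃[ u ] (u ∈ D × Adj G u v)

SameN : ∀ {n} → Graph n → Subset n → Subset n → Set
SameN G D D' = ∀ v → InN G D v ⇔ InN G D' v

NEquals : ∀ {n} → Graph n → Subset n → (Fin n → Set) → Set
NEquals G D P = ∀ v → InN G D v ⇔ P v

MinimalN : ∀ {n} → Graph n → Subset n → Set
MinimalN G D = ∀ D' → D' ⊂ D → ¬ SameN G D' D

IsColorDominating : ∀ {n} → Graph n → (Fin n → Color) → Color → Subset n → Set
IsColorDominating G c col D = NEquals G D (λ v → c v ≡ col)

MinimalColorDominating : ∀ {n} → Graph n → (Fin n → Color) → Color → Subset n → Set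
MinimalColorDominating G c col D = IsColorDominating G c col D × MinimalN G D

IsTotalDominating : ∀ {n} → Graph n → Subset n → Set
IsTotalDominating G S = ∀ v → InN G S v

MinimalTotalDominating : ∀ {n} → Graph n → Subset n → Set
MinimalTotalDominating G S =
  IsTotalDominating G S × (∀ S' → S' ⊂ S → ¬ IsTotalDominating G S')

AllSameSize : ∀ {n} → (Subset n → Set) → Set
AllSameSize P = ∀ D D' → P D → P D' → ∣ D ∣ ≡ ∣ D' ∣

WellTotallyDominated : ∀ {n} → Graph n → Set
WellTotallyDominated G = AllSameSize (MinimalTotalDominating G)

{-# OPTIONS --safe #-}
-- Let B and R be the blue and red vertices. In a properly coloured graph N(X ∩ B) ⊆ R and
-- N(X ∩ R) ⊆ B, so S is a minimal total dominating set exactly when S ∩ B is a minimal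
-- red-dominating set and S ∩ R a minimal blue-dominating set. If no vertex is isolated, every
-- red-dominating set lies inside B and every blue-dominating set inside R, so S ↦ (S ∩ B, S ∩ R)
-- is a bijection onto pairs of such sets with |S| = |S ∩ B| + |S ∩ R|, and both directions
-- follow by comparing sizes; for "⇒" one fixes a minimal dominating set of the other colour.
module Submission where

open import Defs
open import Data.Bool using (Bool; true; not)
open import Data.Empty using (⊥-elim)
open import Data.Fin using (Fin; zero; suc)
open import Data.Fin.Subset
  using (Subset; inside; outside; _∈_; _∉_; _⊆_; _⊂_; _∩_; _∪_; ∁; ∣_∣)
open import Data.Fin.Subset.Induction using (⊂-wellFounded)
open import Data.Fin.Subset.Properties
  using (⊆-antisym; p∩q⊆p; x∈p∩q⁺; x∈p∩q⁻; p⊆p∪q; q⊆p∪q; x∈p∪q⁻; ∪-comm)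
open import Data.Nat using (ℕ; suc; _+_; _≥_; s≤s)
open import Data.Nat.Properties using (+-suc; +-cancelʳ-≡) renaming (_≟_ to _≟ℕ_)
open import Data.Product using (_×_; _,_; proj₁; proj₂; ∃)
open import Data.Sum using (_⊎_; inj₁; inj₂)
open import Data.Vec using (tabulate; []; _∷_)
open import Data.Vec.Properties
  using (lookup∘tabulate; []=⇒lookup; lookup⇒[]=; tabulate-cong; tabulate-∘)
open import Function.Bundles using (_⇔_; mk⇔; Equivalence)
open import Function.Construct.Composition using (_⇔-∘_)
open import Function.Construct.Symmetry using (⇔-sym)
open import Induction.WellFounded using (Acc; acc)
open import Relation.Binary.Definitions using (DecidableEquality)
open import Relation.Nullary using (¬_; yes; no; does)
open import Relation.Nullary.Decidable using (decidable-stable; dec-true)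
import Relation.Binary.PropositionalEquality as ≡
open ≡ using (_≡_; _≢_; refl; cong; cong₂; subst; subst₂; module ≡-Reasoning)

open Equivalence using (to; from)

opposite : Color → Color
opposite red  = blue
opposite blue = red

opposite-involutive : ∀ k → opposite (opposite k) ≡ k
opposite-involutive red  = refl
opposite-involutive blue = refl

opposite-≢ : ∀ k → opposite k ≢ k
opposite-≢ red  ()
opposite-≢ blue ()

opposite-injective : ∀ {a b} → opposite a ≡ opposite b → a ≡ b
opposite-injective {red}  {red}  _ = refl
opposite-injective {blue} {blue} _ = refl

≡⊎≡opposite : ∀ a k → a ≡ k ⊎ a ≡ opposite k
≡⊎≡opposite red  red  = inj₁ refl
≡⊎≡opposite red  blue = inj₂ refl
≡⊎≡opposite blue red  = inj₂ refl
≡⊎≡opposite blue blue = inj₁ refl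

≢⇒≡opposite : ∀ {a b} → a ≢ b → a ≡ opposite b
≢⇒≡opposite {red}  {red}  a≢b = ⊥-elim (a≢b refl)
≢⇒≡opposite {red}  {blue} _   = refl
≢⇒≡opposite {blue} {red}  _   = refl
≢⇒≡opposite {blue} {blue} a≢b = ⊥-elim (a≢b refl)

_≟ᶜ_ : DecidableEquality Color
red  ≟ᶜ red  = yes refl
red  ≟ᶜ blue = no λ ()
blue ≟ᶜ red  = no λ ()
blue ≟ᶜ blue = yes refl

does-≟ᶜ-opposite : ∀ a k → does (a ≟ᶜ opposite k) ≡ not (does (a ≟ᶜ k))
does-≟ᶜ-opposite red  red  = refl
does-≟ᶜ-opposite red  blue = refl
does-≟ᶜ-opposite blue red  = refl
does-≟ᶜ-opposite blue blue = refl

∈-tabulate⁺ : ∀ {n} (f : Fin n → Bool) {x} → f x ≡ true → x ∈ tabulate f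
∈-tabulate⁺ f {x} fx = lookup⇒[]= x (tabulate f) (≡.trans (lookup∘tabulate f x) fx)

∈-tabulate⁻ : ∀ {n} (f : Fin n → Bool) {x} → x ∈ tabulate f → f x ≡ true
∈-tabulate⁻ f {x} x∈ = ≡.trans (≡.sym (lookup∘tabulate f x)) ([]=⇒lookup x∈)

∣p∣≡∣p∩q∣+∣p∩∁q∣ : ∀ {n} (p q : Subset n) → ∣ p ∣ ≡ ∣ p ∩ q ∣ + ∣ p ∩ ∁ q ∣
∣p∣≡∣p∩q∣+∣p∩∁q∣ []            []            = refl
∣p∣≡∣p∩q∣+∣p∩∁q∣ (inside  ∷ p) (inside  ∷ q) = cong suc (∣p∣≡∣p∩q∣+∣p∩∁q∣ p q)
∣p∣≡∣p∩q∣+∣p∩∁q∣ (inside  ∷ p) (outside ∷ q) =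
  ≡.trans (cong suc (∣p∣≡∣p∩q∣+∣p∩∁q∣ p q)) (≡.sym (+-suc _ _))
∣p∣≡∣p∩q∣+∣p∩∁q∣ (outside ∷ p) (inside  ∷ q) = ∣p∣≡∣p∩q∣+∣p∩∁q∣ p q
∣p∣≡∣p∩q∣+∣p∩∁q∣ (outside ∷ p) (outside ∷ q) = ∣p∣≡∣p∩q∣+∣p∩∁q∣ p q

∩-monoˡ-⊆ : ∀ {n} {p q : Subset n} r → p ⊆ q → p ∩ r ⊆ q ∩ r
∩-monoˡ-⊆ {p = p} r p⊆q x∈p∩r with x∈p∩q⁻ p r x∈p∩r
... | x∈p , x∈r = x∈p∩q⁺ (p⊆q x∈p , x∈r)

[p∪q]∩r≡p : ∀ {n} {p q r : Subset n} → p ⊆ r → (∀ {x} → x ∈ q → x ∉ r) → (p ∪ q) ∩ r ≡ p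
[p∪q]∩r≡p {p = p} {q} {r} p⊆r q∉r = ⊆-antisym ⊆p (λ x∈p → x∈p∩q⁺ (p⊆p∪q q x∈p , p⊆r x∈p))
  where
  ⊆p : (p ∪ q) ∩ r ⊆ p
  ⊆p x∈ with x∈p∩q⁻ (p ∪ q) r x∈
  ... | x∈p∪q , x∈r with x∈p∪q⁻ p q x∈p∪q
  ...   | inj₁ x∈p = x∈p
  ...   | inj₂ x∈q = ⊥-elim (q∉r x∈q x∈r)

¬¬∃-⊂-minimal : ∀ {n} {P : Subset n → Set} {X} →
                P X → ¬ ¬ ∃ λ Y → P Y × (∀ Z → Z ⊂ Y → ¬ P Z)
¬¬∃-⊂-minimal {P = P} {X} PX = descend (⊂-wellFounded X) PX
  where
  descend : ∀ {Y} → Acc _⊂_ Y → P Y → ¬ ¬ ∃ λ Y → P Y × (∀ Z → Z ⊂ Y → ¬ P Z)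
  descend (acc below) PY noMinimal =
    noMinimal (_ , PY , λ Z Z⊂Y PZ → descend (below Z⊂Y) PZ noMinimal)

module _ {n} (G : Graph n) where

  Adj-sym : ∀ {u v} → Adj G u v → Adj G v u
  Adj-sym {u} {v} uv = ≡.trans (sym G v u) uv

  InN-mono : ∀ {X Y v} → X ⊆ Y → InN G X v → InN G Y v
  InN-mono X⊆Y (u , u∈X , uv) = u , X⊆Y u∈X , uv

  NEquals⇒SameN : ∀ {D D' P} → NEquals G D P → NEquals G D' P → SameN G D D'
  NEquals⇒SameN N[D]≡P N[D']≡P v = ⇔-sym (N[D']≡P v) ⇔-∘ N[D]≡P v

  NEquals-resp-SameN : ∀ {D D' P} → SameN G D' D → NEquals G D P → NEquals G D' P
  NEquals-resp-SameN N[D']≡N[D] N[D]≡P v = N[D]≡P v ⇔-∘ N[D']≡N[D] v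

  walk⇒neighbour : ∀ {u v} → Walk G u v → u ≢ v → ∃ λ w → Adj G w u
  walk⇒neighbour here         u≢u = ⊥-elim (u≢u refl)
  walk⇒neighbour (step uw _) _   = _ , Adj-sym uw

  connected⇒noIsolated : n ≥ 2 → Connected G → ∀ v → ∃ λ u → Adj G u v
  connected⇒noIsolated (s≤s (s≤s _)) connected zero    =
    walk⇒neighbour (connected zero (suc zero)) λ ()
  connected⇒noIsolated (s≤s (s≤s _)) connected (suc v) =
    walk⇒neighbour (connected (suc v) zero) λ ()

module ProperlyColored {n} (G : Graph n) (c : Fin n → Color) (proper : ProperColoring G c) where

  colorClass : Color → Subset n
  colorClass k = tabulate λ v → does (c v ≟ᶜ k)

  ∈colorClass⁺ : ∀ {k v} → c v ≡ k → v ∈ colorClass k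
  ∈colorClass⁺ {k} {v} cv≡k = ∈-tabulate⁺ (λ w → does (c w ≟ᶜ k)) (dec-true (c v ≟ᶜ k) cv≡k)

  ∈colorClass⁻ : ∀ {k v} → v ∈ colorClass k → c v ≡ k
  ∈colorClass⁻ {k} {v} v∈ with c v ≟ᶜ k | ∈-tabulate⁻ (λ w → does (c w ≟ᶜ k)) v∈
  ... | yes cv≡k | _ = cv≡k
  ... | no _     | ()

  colorClass-opposite : ∀ k → colorClass (opposite k) ≡ ∁ (colorClass k)
  colorClass-opposite k =
    ≡.trans (tabulate-cong λ v → does-≟ᶜ-opposite (c v) k) (tabulate-∘ not λ v → does (c v ≟ᶜ k))

  colorClass-opposite-disjoint : ∀ {k v} → v ∈ colorClass (opposite k) → v ∉ colorClass k
  colorClass-opposite-disjoint {k} v∈opp v∈k =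
    opposite-≢ k (≡.trans (≡.sym (∈colorClass⁻ v∈opp)) (∈colorClass⁻ v∈k))

  ∣∣-split-colorClass :
    ∀ k S → ∣ S ∣ ≡ ∣ S ∩ colorClass k ∣ + ∣ S ∩ colorClass (opposite k) ∣
  ∣∣-split-colorClass k S rewrite colorClass-opposite k =
    ∣p∣≡∣p∩q∣+∣p∩∁q∣ S (colorClass k)

  adjacent-opposite : ∀ {u v} → Adj G u v → c v ≡ opposite (c u)
  adjacent-opposite {u} {v} uv = ≢⇒≡opposite λ cv≡cu → proper u v uv (≡.sym cv≡cu)

  InN-colorClass : ∀ {X k v} → X ⊆ colorClass k → InN G X v → c v ≡ opposite k
  InN-colorClass X⊆k (u , u∈X , uv) =
    ≡.trans (adjacent-opposite uv) (cong opposite (∈colorClass⁻ (X⊆k u∈X)))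

  ∈colorClass-of-neighbour : ∀ {k u v} → Adj G u v → c v ≡ opposite k → u ∈ colorClass k
  ∈colorClass-of-neighbour uv cv≡k' =
    ∈colorClass⁺ (opposite-injective (≡.trans (≡.sym (adjacent-opposite uv)) cv≡k'))

  ∩colorClass-dominating : ∀ {S} k → IsTotalDominating G S →
                           IsColorDominating G c (opposite k) (S ∩ colorClass k)
  ∩colorClass-dominating {S} k total v =
    mk⇔ (InN-colorClass λ x∈ → proj₂ (x∈p∩q⁻ S _ x∈)) dominated
    where
    dominated : c v ≡ opposite k → InN G (S ∩ colorClass k) v
    dominated cv≡k' with total v
    ... | u , u∈S , uv = u , x∈p∩q⁺ (u∈S , ∈colorClass-of-neighbour uv cv≡k') , uv

  -- Otherwise D ∪ (S ∩ colorClass (opposite k)) would be a smaller total dominating set.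
  ∩colorClass-minimal : ∀ {S} k → MinimalTotalDominating G S → MinimalN G (S ∩ colorClass k)
  ∩colorClass-minimal {S} k (total , minimal) D (D⊆S∩k , x , x∈S∩k , x∉D) N[D]≡N[S∩k] =
    minimal S' (S'⊆S , x , p∩q⊆p S _ x∈S∩k , x∉S') S'-total
    where
    S' : Subset n
    S' = D ∪ (S ∩ colorClass (opposite k))

    S'⊆S : S' ⊆ S
    S'⊆S y∈S' with x∈p∪q⁻ D _ y∈S'
    ... | inj₁ y∈D    = p∩q⊆p S _ (D⊆S∩k y∈D)
    ... | inj₂ y∈S∩k' = p∩q⊆p S _ y∈S∩k'

    x∉S' : x ∉ S'
    x∉S' x∈S' with x∈p∪q⁻ D _ x∈S'
    ... | inj₁ x∈D    = x∉D x∈D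
    ... | inj₂ x∈S∩k' =
      colorClass-opposite-disjoint (proj₂ (x∈p∩q⁻ S _ x∈S∩k')) (proj₂ (x∈p∩q⁻ S _ x∈S∩k))

    S'-total : IsTotalDominating G S'
    S'-total v with total v
    ... | u , u∈S , uv with ≡⊎≡opposite (c u) k
    ...   | inj₁ cu≡k  = InN-mono G (p⊆p∪q _)
                           (from (N[D]≡N[S∩k] v) (u , x∈p∩q⁺ (u∈S , ∈colorClass⁺ cu≡k) , uv))
    ...   | inj₂ cu≡k' = u , q⊆p∪q D _ (x∈p∩q⁺ (u∈S , ∈colorClass⁺ cu≡k')) , uv

  minimalTotalDominating⇒parts : ∀ {S} → MinimalTotalDominating G S →
    ∀ k → MinimalColorDominating G c (opposite k) (S ∩ colorClass k)
  minimalTotalDominating⇒parts S-minimal k =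
    ∩colorClass-dominating k (proj₁ S-minimal) , ∩colorClass-minimal k S-minimal

  parts⇒minimalTotalDominating : ∀ {S} →
    (∀ k → MinimalColorDominating G c (opposite k) (S ∩ colorClass k)) → MinimalTotalDominating G S
  parts⇒minimalTotalDominating {S} parts = total , minimal
    where
    total : IsTotalDominating G S
    total v = InN-mono G (p∩q⊆p S _)
      (from (proj₁ (parts (opposite (c v))) v) (≡.sym (opposite-involutive (c v))))

    minimal : ∀ S' → S' ⊂ S → ¬ IsTotalDominating G S'
    minimal S' (S'⊆S , x , x∈S , x∉S') S'-total =
      proj₂ (parts (c x)) (S' ∩ colorClass (c x))
        (∩-monoˡ-⊆ _ S'⊆S , x , x∈p∩q⁺ (x∈S , ∈colorClass⁺ refl) ,
         λ x∈S'∩ → x∉S' (p∩q⊆p S' _ x∈S'∩))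
        (NEquals⇒SameN G (∩colorClass-dominating (c x) S'-total) (proj₁ (parts (c x))))

  sameSize⇒wellTotallyDominated : AllSameSize (MinimalColorDominating G c red) →
    AllSameSize (MinimalColorDominating G c blue) → WellTotallyDominated G
  sameSize⇒wellTotallyDominated sameRed sameBlue S S' S-minimal S'-minimal = begin
    ∣ S ∣                                              ≡⟨ ∣∣-split-colorClass blue S ⟩
    ∣ S ∩ colorClass blue ∣ + ∣ S ∩ colorClass red ∣   ≡⟨ cong₂ _+_
      (sameRed _ _ (minimalTotalDominating⇒parts S-minimal blue)
                   (minimalTotalDominating⇒parts S'-minimal blue))
      (sameBlue _ _ (minimalTotalDominating⇒parts S-minimal red)
                    (minimalTotalDominating⇒parts S'-minimal red)) ⟩
    ∣ S' ∩ colorClass blue ∣ + ∣ S' ∩ colorClass red ∣ ≡⟨ ∣∣-split-colorClass blue S' ⟨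
    ∣ S' ∣                                             ∎
    where open ≡-Reasoning

  module WithoutIsolatedVertices (noIsolated : ∀ v → ∃ λ u → Adj G u v) where

    colorClass-dominating : ∀ k → IsColorDominating G c (opposite k) (colorClass k)
    colorClass-dominating k v = mk⇔ (InN-colorClass λ v∈ → v∈) λ cv≡k' →
      let u , uv = noIsolated v in u , ∈colorClass-of-neighbour uv cv≡k' , uv

    colorDominating⊆colorClass : ∀ {k D} → IsColorDominating G c (opposite k) D →
                                 D ⊆ colorClass k
    colorDominating⊆colorClass D-dominating {u} u∈D =
      let w , wu = noIsolated u
          uw = Adj-sym G wu
      in ∈colorClass-of-neighbour uw (to (D-dominating w) (u , u∈D , uw))

    ¬¬∃-minimalColorDominating : ∀ k → ¬ ¬ ∃ (MinimalColorDominating G c k)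
    ¬¬∃-minimalColorDominating k noneMinimal =
      ¬¬∃-⊂-minimal class-dominating λ (D , D-dominating , noneBelow) →
        noneMinimal (D , D-dominating , λ D' D'⊂D N[D']≡N[D] →
          noneBelow D' D'⊂D (NEquals-resp-SameN G N[D']≡N[D] D-dominating))
      where
      class-dominating : IsColorDominating G c k (colorClass (opposite k))
      class-dominating = subst (λ k' → IsColorDominating G c k' (colorClass (opposite k)))
                               (opposite-involutive k) (colorClass-dominating (opposite k))

    module _ {k D E} (D-minimal : MinimalColorDominating G c (opposite k) D)
                     (E-minimal : MinimalColorDominating G c k E) where

      private
        E-dominating′ : IsColorDominating G c (opposite (opposite k)) E
        E-dominating′ = subst (λ k' → IsColorDominating G c k' E)
                              (≡.sym (opposite-involutive k)) (proj₁ E-minimal)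

        D⊆k : D ⊆ colorClass k
        D⊆k = colorDominating⊆colorClass (proj₁ D-minimal)

        E⊆k′ : E ⊆ colorClass (opposite k)
        E⊆k′ = colorDominating⊆colorClass E-dominating′

      [D∪E]∩colorClass≡D : (D ∪ E) ∩ colorClass k ≡ D
      [D∪E]∩colorClass≡D = [p∪q]∩r≡p D⊆k λ x∈E → colorClass-opposite-disjoint (E⊆k′ x∈E)

      [D∪E]∩colorClass-opposite≡E : (D ∪ E) ∩ colorClass (opposite k) ≡ E
      [D∪E]∩colorClass-opposite≡E =
        ≡.trans (cong (_∩ colorClass (opposite k)) (∪-comm D E))
                ([p∪q]∩r≡p E⊆k′ λ x∈D x∈k′ → colorClass-opposite-disjoint x∈k′ (D⊆k x∈D))

      ∪-minimalTotalDominating : MinimalTotalDominating G (D ∪ E)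
      ∪-minimalTotalDominating = parts⇒minimalTotalDominating part
        where
        part : ∀ k' → MinimalColorDominating G c (opposite k') ((D ∪ E) ∩ colorClass k')
        part k' with ≡⊎≡opposite k' k
        ... | inj₁ refl = subst (MinimalColorDominating G c (opposite k))
                                (≡.sym [D∪E]∩colorClass≡D) D-minimal
        ... | inj₂ refl = subst₂ (MinimalColorDominating G c)
                                 (≡.sym (opposite-involutive k))
                                 (≡.sym [D∪E]∩colorClass-opposite≡E) E-minimal

      ∣D∪E∣≡∣D∣+∣E∣ : ∣ D ∪ E ∣ ≡ ∣ D ∣ + ∣ E ∣
      ∣D∪E∣≡∣D∣+∣E∣ = ≡.trans (∣∣-split-colorClass k (D ∪ E))
        (cong₂ _+_ (cong ∣_∣ [D∪E]∩colorClass≡D) (cong ∣_∣ [D∪E]∩colorClass-opposite≡E))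

    -- A minimal k-dominating set E exists only up to double negation; this suffices
    -- because equality of sizes is decidable.
    wellTotallyDominated⇒sameSize : WellTotallyDominated G →
      ∀ k → AllSameSize (MinimalColorDominating G c (opposite k))
    wellTotallyDominated⇒sameSize wtd k D D' D-minimal D'-minimal =
      decidable-stable (∣ D ∣ ≟ℕ ∣ D' ∣) λ ∣D∣≢∣D'∣ →
        ¬¬∃-minimalColorDominating k λ (E , E-minimal) → ∣D∣≢∣D'∣ (+-cancelʳ-≡ _ _ _ (begin
          ∣ D ∣ + ∣ E ∣   ≡⟨ ∣D∪E∣≡∣D∣+∣E∣ D-minimal E-minimal ⟨
          ∣ D ∪ E ∣       ≡⟨ wtd _ _ (∪-minimalTotalDominating D-minimal E-minimal)
                                     (∪-minimalTotalDominating D'-minimal E-minimal) ⟩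
          ∣ D' ∪ E ∣      ≡⟨ ∣D∪E∣≡∣D∣+∣E∣ D'-minimal E-minimal ⟩
          ∣ D' ∣ + ∣ E ∣  ∎))
      where open ≡-Reasoning

corollary3p12 : (n : ℕ) → n ≥ 2 → (T : Graph n) → IsTree T →
    (c : Fin n → Color) → ProperColoring T c →
    WellTotallyDominated T ⇔
      (AllSameSize (MinimalColorDominating T c red) ×
       AllSameSize (MinimalColorDominating T c blue))
corollary3p12 n n≥2 T (connected , _) c proper = mk⇔
  (λ wtd → wellTotallyDominated⇒sameSize wtd blue , wellTotallyDominated⇒sameSize wtd red)
  (λ (sameRed , sameBlue) → sameSize⇒wellTotallyDominated sameRed sameBlue)
  where
  open ProperlyColored T c proper
  open WithoutIsolatedVertices (connected⇒noIsolated T n≥2 connected)
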